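{- Let $G$ be a finite simple graph of order $n$ with minimum degree $\delta \geq 1$. Then $$\gamma^{0}_{st}(G) \leq n - 2\left\lceil \frac{2\gamma_t(G) + \delta - 2}{2} \right\rceil .$$ Moreover, this bound is sharp: equality holds for every complete graph $K_n$ with $n \geq 2$ and for every cycle $C_n$ with $n \geq 3$.
   Context: For a vertex $v$, $N(v)$ denotes its open neighborhood. For $f: V(G) \to \mathbb{R}$ and $B \subseteq V(G)$ write $f(B) = \sum_{v \in B} f(v)$; $f(V(G))$ is the weight of $f$. An inverse signed total dominating function (ISTDF) of $G$ is a function $f: V(G) \to \{ -1,1\}$ with $f(N(v)) \leq 0$ for every vertex $v$. The inverse signed total domination number $\gamma^{0}_{st}(G)$ is the maximum weight of an ISTDF of $G$. A set $D \subseteq V(G)$ is a total dominating set if every vertex of $G$ is adjacent to at least one vertex of $D$; $\gamma_t(G)$ is the minimum cardinality of a total dominating set. -}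

module Defs where

open import Data.Bool using (Bool; true; false; if_then_else_; not; _∨_; _∧_)
open import Data.Nat as ℕ using (ℕ; zero; suc; _≡ᵇ_)
open import Data.Fin using (Fin; toℕ) renaming (zero to fzero; suc to fsuc)
open import Data.Integer as ℤ using (ℤ; +_; -[1+_])
open import Data.Product using (Σ; _×_; ∃)
open import Data.Sum using (_⊎_)
open import Relation.Binary.PropositionalEquality using (_≡_)

Graph : ℕ → Set
Graph n = Fin n → Fin n → Bool

IsSimple : ∀ {n} → Graph n → Set
IsSimple {n} G = (∀ u v → G u v ≡ G v u) × (∀ v → G v v ≡ false)

sumℤ : ∀ n → (Fin n → ℤ) → ℤ
sumℤ zero    f = + 0
sumℤ (suc n) f = f fzero ℤ.+ sumℤ n (λ i → f (fsuc i))

sumℕ : ∀ n → (Fin n → ℕ) → ℕ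
sumℕ zero    f = 0
sumℕ (suc n) f = f fzero ℕ.+ sumℕ n (λ i → f (fsuc i))

deg : ∀ {n} → Graph n → Fin n → ℕ
deg {n} G v = sumℕ n (λ u → if G v u then 1 else 0)

IsMinDegree : ∀ {n} → Graph n → ℕ → Set
IsMinDegree G d = (∃ λ v → deg G v ≡ d) × (∀ v → d ℕ.≤ deg G v)

nbhdSum : ∀ {n} → Graph n → (Fin n → ℤ) → Fin n → ℤ
nbhdSum {n} G f v = sumℤ n (λ u → if G v u then f u else + 0)

weight : ∀ {n} → (Fin n → ℤ) → ℤ
weight {n} f = sumℤ n f

IsISTDF : ∀ {n} → Graph n → (Fin n → ℤ) → Set
IsISTDF G f = (∀ v → (f v ≡ + 1) ⊎ (f v ≡ -[1+ 0 ])) × (∀ v → nbhdSum G f v ℤ.≤ + 0)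

IsInvSignedTotalDomNum : ∀ {n} → Graph n → ℤ → Set
IsInvSignedTotalDomNum G g =
  (∃ λ f → IsISTDF G f × weight f ≡ g) × (∀ f → IsISTDF G f → weight f ℤ.≤ g)

card : ∀ {n} → (Fin n → Bool) → ℕ
card {n} D = sumℕ n (λ u → if D u then 1 else 0)

IsTotalDominatingSet : ∀ {n} → Graph n → (Fin n → Bool) → Set
IsTotalDominatingSet G D = ∀ v → ∃ λ u → (D u ≡ true) × (G v u ≡ true)

IsTotalDomNum : ∀ {n} → Graph n → ℕ → Set
IsTotalDomNum G t =
  (∃ λ D → IsTotalDominatingSet G D × card D ≡ t)
  × (∀ D → IsTotalDominatingSet G D → t ℕ.≤ card D)

bound : ℕ → ℕ → ℕ → ℤ
bound n t δ = + n ℤ.- + (2 ℕ.* ℕ.⌈ (2 ℕ.* t ℕ.+ δ) ℕ.∸ 2 /2⌉)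

complete : ∀ n → Graph n
complete n i j = not (toℕ i ≡ᵇ toℕ j)

-- cycle C_n on vertices 0,1,…,n-1 with i ~ i+1 (mod n)
cycle : ∀ n → Graph n
cycle n i j =
  (toℕ j ≡ᵇ suc (toℕ i)) ∨ (toℕ i ≡ᵇ suc (toℕ j))
  ∨ ((toℕ i ≡ᵇ 0) ∧ (suc (toℕ j) ≡ᵇ n))
  ∨ ((toℕ j ≡ᵇ 0) ∧ (suc (toℕ i) ≡ᵇ n))

-- An ISTDF f is determined by its set M of vertices labelled -1: f(N(v)) ≤ 0 says exactly
-- that M contains at least half of N(v), and f has weight n - 2|M|. So every vertex has at
-- least ⌈δ/2⌉ neighbours in M. Deleting a vertex of M costs every vertex at most one of them,
-- hence deleting any ⌈δ/2⌉ - 1 vertices of M leaves a total dominating set, and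
-- |M| ≥ γ_t + ⌈δ/2⌉ - 1 = ⌈(2γ_t + δ - 2)/2⌉. For sharpness, in K_n (where γ_t = 2) any
-- ⌈(n+1)/2⌉ vertices meet every neighbourhood in at least half of it, and when all degrees
-- are at most 2, as in C_n, so does a minimum total dominating set.
module Submission where

open import Defs
open import Data.Nat using (ℕ; _≤_)
open import Data.Integer using (ℤ) renaming (_≤_ to _≤ℤ_)
open import Data.Product using (_×_)
open import Relation.Binary.PropositionalEquality using (_≡_)

open import Data.Bool using (Bool; true; false; if_then_else_; not; _∧_; T)
import Data.Bool.Properties as Boolₚ
open import Data.Nat using (zero; suc; _+_; _*_; _∸_; _≡ᵇ_; _<ᵇ_; ⌊_/2⌋; ⌈_/2⌉; z≤n; s≤s)
import Data.Nat.Properties as ℕₚ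
import Data.Nat.Tactic.RingSolver as ℕ-Solver
import Data.Integer.Tactic.RingSolver as ℤ-Solver
import Algebra.Properties.CommutativeSemigroup as CommutativeSemigroupProperties
open import Data.Integer as ℤ using (+_; -[1+_]; +≤+)
import Data.Integer.Properties as ℤₚ
open import Data.Fin using (Fin; toℕ) renaming (zero to fzero; suc to fsuc)
import Data.Fin.Properties as Finₚ
open import Data.Product using (∃; _,_; proj₁)
open import Data.Sum using (_⊎_; inj₁; inj₂) renaming (map to ⊎-map)
open import Data.Unit using (tt)
open import Data.Empty using (⊥-elim)
open import Function.Bundles using (Equivalence)
open import Relation.Binary.PropositionalEquality
  using (refl; sym; trans; cong; cong₂; subst; module ≡-Reasoning)

module ℕ+ = CommutativeSemigroupProperties ℕₚ.+-commutativeSemigroup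
module ℤ+ = CommutativeSemigroupProperties ℤₚ.+-commutativeSemigroup

private variable
  n : ℕ

indicator : Bool → ℕ
indicator b = if b then 1 else 0

indicator≤1 : ∀ b → indicator b ≤ 1
indicator≤1 true  = s≤s z≤n
indicator≤1 false = z≤n

_∩_ : (Fin n → Bool) → (Fin n → Bool) → Fin n → Bool
(p ∩ q) u = p u ∧ q u

-- Phrased with toℕ and _≡ᵇ_ so that complete n v is definitionally (λ _ → true) ─ v.
_─_ : (Fin n → Bool) → Fin n → Fin n → Bool
(p ─ x) u = p u ∧ not (toℕ x ≡ᵇ toℕ u)

≡ᵇ⇒≡ : ∀ m n → (m ≡ᵇ n) ≡ true → m ≡ n
≡ᵇ⇒≡ m n m≡ᵇn = ℕₚ.≡ᵇ⇒≡ m n (subst T (sym m≡ᵇn) tt)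

≡⇒≡ᵇ : ∀ {m n} → m ≡ n → (m ≡ᵇ n) ≡ true
≡⇒≡ᵇ {m} {n} m≡n = Equivalence.to Boolₚ.T-≡ (ℕₚ.≡⇒≡ᵇ m n m≡n)

sumℕ-cong : ∀ n {h k : Fin n → ℕ} → (∀ u → h u ≡ k u) → sumℕ n h ≡ sumℕ n k
sumℕ-cong zero    h≡k = refl
sumℕ-cong (suc n) h≡k = cong₂ _+_ (h≡k fzero) (sumℕ-cong n (λ u → h≡k (fsuc u)))

sumℕ-mono : ∀ n {h k : Fin n → ℕ} → (∀ u → h u ≤ k u) → sumℕ n h ≤ sumℕ n k
sumℕ-mono zero    h≤k = z≤n
sumℕ-mono (suc n) h≤k = ℕₚ.+-mono-≤ (h≤k fzero) (sumℕ-mono n (λ u → h≤k (fsuc u)))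

sumℕ-+ : ∀ n (h k : Fin n → ℕ) → sumℕ n (λ u → h u + k u) ≡ sumℕ n h + sumℕ n k
sumℕ-+ zero    h k = refl
sumℕ-+ (suc n) h k =
  trans (cong (λ s → h fzero + k fzero + s) (sumℕ-+ n _ _)) (ℕ+.interchange (h fzero) (k fzero) _ _)

card-cong : {p q : Fin n → Bool} → (∀ u → p u ≡ q u) → card p ≡ card q
card-cong p≡q = sumℕ-cong _ (λ u → cong indicator (p≡q u))

card-all : ∀ n → card {n} (λ _ → true) ≡ n
card-all zero    = refl
card-all (suc n) = cong suc (card-all n)

card-remove : (p : Fin n → Bool) (x : Fin n) → card p ≡ indicator (p x) + card (p ─ x)
card-remove {suc n} p fzero rewrite Boolₚ.∧-zeroʳ (p fzero) =
  cong (λ s → indicator (p fzero) + s) (card-cong (λ u → sym (Boolₚ.∧-identityʳ (p (fsuc u)))))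
card-remove {suc n} p (fsuc x) rewrite Boolₚ.∧-identityʳ (p fzero) =
  trans (cong (λ s → indicator (p fzero) + s) (card-remove (λ u → p (fsuc u)) x))
        (ℕ+.x∙yz≈y∙xz (indicator (p fzero)) (indicator (p (fsuc x))) _)

card-none : ∀ n → card {n} (λ _ → false) ≡ 0
card-none zero    = refl
card-none (suc n) = card-none n

card-pos : (p : Fin n → Bool) (x : Fin n) → p x ≡ true → 1 ≤ card p
card-pos p x px rewrite card-remove p x | px = s≤s z≤n

card-pos⇒nonempty : (p : Fin n → Bool) → 1 ≤ card p → ∃ λ u → p u ≡ true
card-pos⇒nonempty {suc n} p 1≤card with p fzero in p0
... | true  = fzero , p0
... | false with card-pos⇒nonempty (λ u → p (fsuc u)) 1≤card
...   | u , pu = fsuc u , pu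

card-∩-remove : (p q : Fin n → Bool) (x : Fin n) → card (p ∩ q) ≤ suc (card (p ∩ (q ─ x)))
card-∩-remove p q x = begin
  card (p ∩ q)                               ≡⟨ card-remove (p ∩ q) x ⟩
  indicator ((p ∩ q) x) + card ((p ∩ q) ─ x) ≤⟨ ℕₚ.+-mono-≤ (indicator≤1 _) (ℕₚ.≤-reflexive
                                                  (card-cong (λ u → Boolₚ.∧-assoc (p u) (q u) _))) ⟩
  suc (card (p ∩ (q ─ x)))                   ∎
  where open ℕₚ.≤-Reasoning

card-cover : (p q r : Fin n → Bool) → (∀ u → p u ≡ true → q u ≡ true ⊎ r u ≡ true) →
             card p ≤ card q + card r
card-cover {n} p q r cover = ℕₚ.≤-trans (sumℕ-mono n pointwise)
  (ℕₚ.≤-reflexive (sumℕ-+ n (λ u → indicator (q u)) (λ u → indicator (r u))))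
  where
  pointwise : ∀ u → indicator (p u) ≤ indicator (q u) + indicator (r u)
  pointwise u with p u in pu
  ... | false = z≤n
  ... | true with cover u pu
  ...   | inj₁ qu rewrite qu = s≤s z≤n
  ...   | inj₂ ru rewrite ru = ℕₚ.m≤n+m 1 (indicator (q u))

card-at≤1 : ∀ n a → card {n} (λ u → toℕ u ≡ᵇ a) ≤ 1
card-at≤1 zero    a       = z≤n
card-at≤1 (suc n) zero    = ℕₚ.≤-reflexive (cong suc (card-none n))
card-at≤1 (suc n) (suc a) = card-at≤1 n a

card-below : ∀ n m → m ≤ n → card {n} (λ u → toℕ u <ᵇ m) ≡ m
card-below n       zero    _         = card-none n
card-below (suc n) (suc m) (s≤s m≤n) = cong suc (card-below n m m≤n)

2*suc : ∀ m n → 2 * suc m + n ≡ suc (suc (2 * m + n))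
2*suc = ℕ-Solver.solve-∀

m≤2n⇒⌈m/2⌉≤n : ∀ m n → m ≤ 2 * n → ⌈ m /2⌉ ≤ n
m≤2n⇒⌈m/2⌉≤n m n m≤2n = ℕₚ.≤-trans (ℕₚ.⌈n/2⌉-mono m≤2n)
  (ℕₚ.≤-reflexive (trans (cong (λ k → ⌈ n + k /2⌉) (ℕₚ.+-identityʳ n)) (sym (ℕₚ.n≡⌈n+n/2⌉ n))))

n≤2*⌈n/2⌉ : ∀ n → n ≤ 2 * ⌈ n /2⌉
n≤2*⌈n/2⌉ n = begin
  n                     ≡⟨ sym (ℕₚ.⌊n/2⌋+⌈n/2⌉≡n n) ⟩
  ⌊ n /2⌋ + ⌈ n /2⌉     ≤⟨ ℕₚ.+-monoˡ-≤ ⌈ n /2⌉ (ℕₚ.⌊n/2⌋≤⌈n/2⌉ n) ⟩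
  ⌈ n /2⌉ + ⌈ n /2⌉     ≡⟨ cong (λ k → ⌈ n /2⌉ + k) (sym (ℕₚ.+-identityʳ ⌈ n /2⌉)) ⟩
  2 * ⌈ n /2⌉           ∎
  where open ℕₚ.≤-Reasoning

⌈2m+n/2⌉≡m+⌈n/2⌉ : ∀ m n → ⌈ 2 * m + n /2⌉ ≡ m + ⌈ n /2⌉
⌈2m+n/2⌉≡m+⌈n/2⌉ zero    n = refl
⌈2m+n/2⌉≡m+⌈n/2⌉ (suc m) n = trans (cong ⌈_/2⌉ (2*suc m n)) (cong suc (⌈2m+n/2⌉≡m+⌈n/2⌉ m n))

⌈2t+δ-2/2⌉≡t+⌊δ-1/2⌋ : ∀ t δ′ → ⌈ (2 * t + suc δ′) ∸ 2 /2⌉ ≡ t + ⌊ δ′ /2⌋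
⌈2t+δ-2/2⌉≡t+⌊δ-1/2⌋ zero    zero     = refl
⌈2t+δ-2/2⌉≡t+⌊δ-1/2⌋ zero    (suc δ′) = refl
⌈2t+δ-2/2⌉≡t+⌊δ-1/2⌋ (suc t) δ′       = begin
  ⌈ (2 * suc t + suc δ′) ∸ 2 /2⌉ ≡⟨ cong (λ m → ⌈ m ∸ 2 /2⌉) (2*suc t (suc δ′)) ⟩
  ⌈ 2 * t + suc δ′ /2⌉          ≡⟨ ⌈2m+n/2⌉≡m+⌈n/2⌉ t (suc δ′) ⟩
  t + suc ⌊ δ′ /2⌋              ≡⟨ ℕₚ.+-suc t _ ⟩
  suc t + ⌊ δ′ /2⌋              ∎
  where open ≡-Reasoning

balance : ℕ → ℕ → ℤ
balance n k = + n ℤ.- + (2 * k)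

balance-antitone : ∀ n {k l} → k ≤ l → balance n l ≤ℤ balance n k
balance-antitone n k≤l = ℤₚ.+-monoʳ-≤ (+ n) (ℤₚ.neg-mono-≤ (+≤+ (ℕₚ.*-monoʳ-≤ 2 k≤l)))

bound≡balance : ∀ n t δ′ → bound n t (suc δ′) ≡ balance n (t + ⌊ δ′ /2⌋)
bound≡balance n t δ′ = cong (balance n) (⌈2t+δ-2/2⌉≡t+⌊δ-1/2⌋ t δ′)

bound≡balance-δ≤2 : ∀ n t {δ} → 1 ≤ δ → δ ≤ 2 → bound n t δ ≡ balance n t
bound≡balance-δ≤2 n t {1} _ _ = trans (bound≡balance n t 0) (cong (balance n) (ℕₚ.+-identityʳ t))
bound≡balance-δ≤2 n t {2} _ _ = trans (bound≡balance n t 1) (cong (balance n) (ℕₚ.+-identityʳ t))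
bound≡balance-δ≤2 n t {suc (suc (suc _))} _ (s≤s (s≤s ()))

module _ {w : ℤ} {a b : ℕ} (w+a≡b : w ℤ.+ + a ≡ + b) where

  w≡b-a : w ≡ + b ℤ.- + a
  w≡b-a = trans (i≡i+j-j w (+ a)) (cong (ℤ._- + a) w+a≡b)
    where
    i≡i+j-j : ∀ i j → i ≡ i ℤ.+ j ℤ.- j
    i≡i+j-j = ℤ-Solver.solve-∀

  w≤0⇒b≤a : w ≤ℤ + 0 → b ≤ a
  w≤0⇒b≤a w≤0 = ℤₚ.drop‿+≤+ (ℤₚ.i-j≤0⇒i≤j (subst (_≤ℤ + 0) w≡b-a w≤0))

  b≤a⇒w≤0 : b ≤ a → w ≤ℤ + 0
  b≤a⇒w≤0 b≤a = subst (_≤ℤ + 0) (sym w≡b-a) (ℤₚ.i≤j⇒i-j≤0 (+≤+ b≤a))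

IsSignFunction : (Fin n → ℤ) → Set
IsSignFunction f = ∀ v → (f v ≡ + 1) ⊎ (f v ≡ -[1+ 0 ])

isNegative : ℤ → Bool
isNegative (+ _)    = false
isNegative -[1+ _ ] = true

negatives : (Fin n → ℤ) → Fin n → Bool
negatives f u = isNegative (f u)

sumOn : (Fin n → Bool) → (Fin n → ℤ) → ℤ
sumOn {n} p f = sumℤ n (λ u → if p u then f u else + 0)

-- A -1 on p contributes -1 + 2 = 1, just like a +1.
sumOn-signs : ∀ n (p : Fin n → Bool) {f : Fin n → ℤ} → IsSignFunction f →
              sumOn p f ℤ.+ + (2 * card (p ∩ negatives f)) ≡ + card p
sumOn-signs zero    p sf = refl
sumOn-signs (suc n) p {f} sf = begin
  (h ℤ.+ S) ℤ.+ + (2 * (c + C))           ≡⟨ cong (λ k → (h ℤ.+ S) ℤ.+ + k) (ℕₚ.*-distribˡ-+ 2 c C) ⟩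
  (h ℤ.+ S) ℤ.+ (+ (2 * c) ℤ.+ + (2 * C)) ≡⟨ ℤ+.interchange h S _ _ ⟩
  (h ℤ.+ + (2 * c)) ℤ.+ (S ℤ.+ + (2 * C)) ≡⟨ cong₂ ℤ._+_ (atVertex (p fzero) (sf fzero))
                                                          (sumOn-signs n _ (λ u → sf (fsuc u))) ⟩
  + card p                                 ∎
  where
  open ≡-Reasoning
  h S : ℤ
  h = if p fzero then f fzero else + 0
  S = sumOn (λ u → p (fsuc u)) (λ u → f (fsuc u))
  c C : ℕ
  c = indicator (p fzero ∧ isNegative (f fzero))
  C = card (λ u → p (fsuc u) ∧ isNegative (f (fsuc u)))
  atVertex : ∀ b {z} → (z ≡ + 1) ⊎ (z ≡ -[1+ 0 ]) →
             (if b then z else + 0) ℤ.+ + (2 * indicator (b ∧ isNegative z)) ≡ + indicator b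
  atVertex false _          = refl
  atVertex true (inj₁ refl) = refl
  atVertex true (inj₂ refl) = refl

weight≡balance : {f : Fin n → ℤ} → IsSignFunction f → weight f ≡ balance n (card (negatives f))
weight≡balance {n} sf =
  w≡b-a (trans (sumOn-signs n (λ _ → true) sf) (cong +_ (card-all n)))

HalvesNeighbourhoods : Graph n → (Fin n → Bool) → Set
HalvesNeighbourhoods G D = ∀ v → deg G v ≤ 2 * card (G v ∩ D)

istdf⇒halves : {G : Graph n} {f : Fin n → ℤ} → IsISTDF G f → HalvesNeighbourhoods G (negatives f)
istdf⇒halves {n} {G} (sf , nonpos) v = w≤0⇒b≤a (sumOn-signs n (G v) sf) (nonpos v)

signsOf : (Fin n → Bool) → Fin n → ℤ
signsOf D u = if D u then -[1+ 0 ] else + 1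

signsOf-isSign : (D : Fin n → Bool) → IsSignFunction (signsOf D)
signsOf-isSign D u with D u
... | true  = inj₂ refl
... | false = inj₁ refl

negatives-signsOf : (D : Fin n → Bool) → ∀ u → negatives (signsOf D) u ≡ D u
negatives-signsOf D u with D u
... | true  = refl
... | false = refl

halves⇒istdf : {G : Graph n} {D : Fin n → Bool} → HalvesNeighbourhoods G D → IsISTDF G (signsOf D)
halves⇒istdf {n} {G} {D} halves = signsOf-isSign D , nonpos
  where
  nonpos : ∀ v → nbhdSum G (signsOf D) v ≤ℤ + 0
  nonpos v = b≤a⇒w≤0 (sumOn-signs n (G v) (signsOf-isSign D))
    (subst (λ k → deg G v ≤ 2 * k)
           (card-cong (λ u → cong (G v u ∧_) (sym (negatives-signsOf D u)))) (halves v))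

balance≤invSignedTotalDomNum : {G : Graph n} {g : ℤ} {D : Fin n → Bool} →
  IsInvSignedTotalDomNum G g → HalvesNeighbourhoods G D → balance n (card D) ≤ℤ g
balance≤invSignedTotalDomNum {n} {D = D} (_ , maximal) halves =
  subst (_≤ℤ _) weight-signsOf (maximal (signsOf D) (halves⇒istdf halves))
  where
  weight-signsOf : weight (signsOf D) ≡ balance n (card D)
  weight-signsOf = trans (weight≡balance (signsOf-isSign D))
                         (cong (balance n) (card-cong (negatives-signsOf D)))

-- Removing a vertex of S costs every vertex at most one neighbour in S, so any j
-- vertices can be removed from S while keeping it a total dominating set.
totalDomNum+j≤card : {G : Graph n} {t : ℕ} → (∀ D → IsTotalDominatingSet G D → t ≤ card D) →
  Fin n → ∀ j (S : Fin n → Bool) → (∀ v → suc j ≤ card (G v ∩ S)) → t + j ≤ card S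
totalDomNum+j≤card {G = G} {t} minimal w zero S enough =
  subst (_≤ card S) (sym (ℕₚ.+-identityʳ t)) (minimal S dominates)
  where
  dominates : IsTotalDominatingSet G S
  dominates v with card-pos⇒nonempty (G v ∩ S) (enough v)
  ... | u , GvS = u , Boolₚ.∧-conicalʳ (G v u) (S u) GvS , Boolₚ.∧-conicalˡ (G v u) (S u) GvS
totalDomNum+j≤card {G = G} {t} minimal w (suc j) S enough
  with card-pos⇒nonempty (G w ∩ S) (ℕₚ.≤-trans (s≤s z≤n) (enough w))
... | x , Gwx∧Sx = begin
  t + suc j                      ≡⟨ ℕₚ.+-suc t j ⟩
  suc (t + j)                    ≤⟨ s≤s (totalDomNum+j≤card minimal w j (S ─ x) enough′) ⟩
  suc (card (S ─ x))             ≡⟨ cong (λ b → indicator b + card (S ─ x)) (sym Sx) ⟩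
  indicator (S x) + card (S ─ x) ≡⟨ sym (card-remove S x) ⟩
  card S                         ∎
  where
  open ℕₚ.≤-Reasoning
  Sx : S x ≡ true
  Sx = Boolₚ.∧-conicalʳ (G w x) (S x) Gwx∧Sx
  enough′ : ∀ v → suc j ≤ card (G v ∩ (S ─ x))
  enough′ v = ℕₚ.≤-pred (ℕₚ.≤-trans (enough v) (card-∩-remove (G v) S x))

halves⇒totalDomNum+⌊δ-1/2⌋≤card : {G : Graph n} {δ′ t : ℕ} {M : Fin n → Bool} →
  IsMinDegree G (suc δ′) → (∀ D → IsTotalDominatingSet G D → t ≤ card D) →
  HalvesNeighbourhoods G M → t + ⌊ δ′ /2⌋ ≤ card M
halves⇒totalDomNum+⌊δ-1/2⌋≤card {δ′ = δ′} {M = M} ((v₀ , _) , δ≤deg) minimal halves =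
  totalDomNum+j≤card minimal v₀ ⌊ δ′ /2⌋ M
    (λ v → m≤2n⇒⌈m/2⌉≤n (suc δ′) _ (ℕₚ.≤-trans (δ≤deg v) (halves v)))

invSignedTotalDomNum≤bound : {G : Graph n} {δ t : ℕ} {g : ℤ} → IsMinDegree G δ → 1 ≤ δ →
  IsInvSignedTotalDomNum G g → IsTotalDomNum G t → g ≤ℤ bound n t δ
invSignedTotalDomNum≤bound {n} {δ = suc δ′} {t} minDeg _ ((f , istdf , refl) , _) (_ , minimal) =
  begin
  weight f                       ≡⟨ weight≡balance (proj₁ istdf) ⟩
  balance n (card (negatives f)) ≤⟨ balance-antitone n
                                      (halves⇒totalDomNum+⌊δ-1/2⌋≤card minDeg minimal (istdf⇒halves istdf)) ⟩
  balance n (t + ⌊ δ′ /2⌋)       ≡⟨ sym (bound≡balance n t δ′) ⟩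
  bound n t (suc δ′)             ∎
  where open ℤₚ.≤-Reasoning

totalDominatingSet⇒minDegree≥1 : {G : Graph n} {D : Fin n → Bool} {δ : ℕ} →
  IsTotalDominatingSet G D → IsMinDegree G δ → 1 ≤ δ
totalDominatingSet⇒minDegree≥1 {G = G} dominates ((v₀ , degv₀≡δ) , _) with dominates v₀
... | u , _ , Gv₀u = subst (1 ≤_) degv₀≡δ (card-pos (G v₀) u Gv₀u)

-- The vertex u dominating v has a neighbour w in D, and w ≠ u because there are no loops.
totalDominatingSet-card≥2 : {G : Graph n} {D : Fin n → Bool} → (∀ v → G v v ≡ false) → Fin n →
  IsTotalDominatingSet G D → 2 ≤ card D
totalDominatingSet-card≥2 {G = G} {D} loopless v dominates with dominates v
... | u , Du , _ with dominates u
...   | w , Dw , Guw = begin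
  2                              ≤⟨ s≤s (card-pos (D ─ u) w (cong₂ _∧_ Dw (cong not u≢w))) ⟩
  suc (card (D ─ u))             ≡⟨ cong (λ b → indicator b + card (D ─ u)) (sym Du) ⟩
  indicator (D u) + card (D ─ u) ≡⟨ sym (card-remove D u) ⟩
  card D                         ∎
  where
  open ℕₚ.≤-Reasoning
  u≢w : (toℕ u ≡ᵇ toℕ w) ≡ false
  u≢w with toℕ u ≡ᵇ toℕ w in u≡ᵇw
  ... | false = refl
  ... | true with trans (sym (loopless u))
                        (subst (λ x → G u x ≡ true) (sym (Finₚ.toℕ-injective (≡ᵇ⇒≡ _ _ u≡ᵇw))) Guw)
  ...   | ()

totalDominatingSet-halves : {G : Graph n} {D : Fin n → Bool} → (∀ v → deg G v ≤ 2) →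
  IsTotalDominatingSet G D → HalvesNeighbourhoods G D
totalDominatingSet-halves {G = G} {D} deg≤2 dominates v with dominates v
... | u , Du , Gvu =
  ℕₚ.≤-trans (deg≤2 v) (ℕₚ.*-monoʳ-≤ 2 (card-pos (G v ∩ D) u (cong₂ _∧_ Gvu Du)))

-- A minimum total dominating set then meets half of every neighbourhood, giving weight n - 2γ_t;
-- and δ ∈ {1, 2} makes the bound n - 2γ_t as well.
invSignedTotalDomNum≡bound-deg≤2 : {G : Graph n} {δ t : ℕ} {g : ℤ} → (∀ v → deg G v ≤ 2) →
  IsMinDegree G δ → IsInvSignedTotalDomNum G g → IsTotalDomNum G t → g ≡ bound n t δ
invSignedTotalDomNum≡bound-deg≤2 {n} {G} {δ} {t} {g} deg≤2 minDeg@((v₀ , degv₀≡δ) , _) isγ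
                                 isγt@((D , dominates , |D|≡t) , _) =
  ℤₚ.≤-antisym (invSignedTotalDomNum≤bound minDeg 1≤δ isγ isγt) (begin
    bound n t δ        ≡⟨ bound≡balance-δ≤2 n t 1≤δ δ≤2 ⟩
    balance n t        ≡⟨ cong (balance n) (sym |D|≡t) ⟩
    balance n (card D) ≤⟨ balance≤invSignedTotalDomNum {G = G} {D = D} isγ
                            (totalDominatingSet-halves deg≤2 dominates) ⟩
    g                  ∎)
  where
  open ℤₚ.≤-Reasoning
  1≤δ : 1 ≤ δ
  1≤δ = totalDominatingSet⇒minDegree≥1 dominates minDeg
  δ≤2 : δ ≤ 2
  δ≤2 = subst (_≤ 2) degv₀≡δ (deg≤2 v₀)

deg-complete : ∀ n (v : Fin n) → suc (deg (complete n) v) ≡ n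
deg-complete n v = trans (sym (card-remove (λ _ → true) v)) (card-all n)

complete-loopless : ∀ n (v : Fin n) → complete n v v ≡ false
complete-loopless n v = cong not (≡⇒≡ᵇ {toℕ v} refl)

halves-complete : ∀ {n} (S : Fin (suc n) → Bool) k → card S ≡ suc k → n ≤ 2 * k →
  HalvesNeighbourhoods (complete (suc n)) S
halves-complete {n} S k |S|≡1+k n≤2k v = begin
  deg (complete (suc n)) v         ≡⟨ ℕₚ.suc-injective (deg-complete (suc n) v) ⟩
  n                                ≤⟨ n≤2k ⟩
  2 * k                            ≤⟨ ℕₚ.*-monoʳ-≤ 2 k≤|Nv∩S| ⟩
  2 * card (complete (suc n) v ∩ S) ∎
  where
  open ℕₚ.≤-Reasoning
  k≤|Nv∩S| : k ≤ card (complete (suc n) v ∩ S)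
  k≤|Nv∩S| = ℕₚ.≤-pred (begin
    suc k                               ≡⟨ sym |S|≡1+k ⟩
    card S                              ≤⟨ card-∩-remove (λ _ → true) S v ⟩
    suc (card (S ─ v))                  ≡⟨ cong suc (card-cong (λ u →
                                             Boolₚ.∧-comm (S u) (complete (suc n) v u))) ⟩
    suc (card (complete (suc n) v ∩ S)) ∎)

-- The witness labels the first ⌈(n-1)/2⌉ + 1 vertices with -1; γ_t ≥ 2 closes the gap.
invSignedTotalDomNum≡bound-complete : {δ t : ℕ} {g : ℤ} → 2 ≤ n → IsMinDegree (complete n) δ →
  IsInvSignedTotalDomNum (complete n) g → IsTotalDomNum (complete n) t → g ≡ bound n t δ
invSignedTotalDomNum≡bound-complete {suc zero} (s≤s ()) _ _ _
invSignedTotalDomNum≡bound-complete {suc (suc n′)} {δ} {t} {g} _ minDeg@((v₀ , degv₀≡δ) , _) isγ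
                       isγt@((_ , dominates , |D|≡t) , _) =
  ℤₚ.≤-antisym (invSignedTotalDomNum≤bound minDeg 1≤δ isγ isγt)
               (subst (λ d → bound N t d ≤ℤ g) (sym δ≡1+n′) lower)
  where
  N : ℕ
  N = suc (suc n′)
  k : ℕ
  k = ⌈ suc n′ /2⌉
  M : Fin N → Bool
  M u = toℕ u <ᵇ suc k
  δ≡1+n′ : δ ≡ suc n′
  δ≡1+n′ = trans (sym degv₀≡δ) (ℕₚ.suc-injective (deg-complete N v₀))
  1≤δ : 1 ≤ δ
  1≤δ = subst (1 ≤_) (sym δ≡1+n′) (s≤s z≤n)
  2≤t : 2 ≤ t
  2≤t = subst (2 ≤_) |D|≡t (totalDominatingSet-card≥2 (complete-loopless N) v₀ dominates)
  |M|≡1+k : card M ≡ suc k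
  |M|≡1+k = card-below N (suc k) (s≤s (ℕₚ.⌈n/2⌉≤n (suc n′)))
  lower : bound N t (suc n′) ≤ℤ g
  lower = begin
    bound N t (suc n′)        ≡⟨ bound≡balance N t n′ ⟩
    balance N (t + ⌊ n′ /2⌋)  ≤⟨ balance-antitone N (ℕₚ.+-monoˡ-≤ ⌊ n′ /2⌋ 2≤t) ⟩
    balance N (suc k)         ≡⟨ cong (balance N) (sym |M|≡1+k) ⟩
    balance N (card M)        ≤⟨ balance≤invSignedTotalDomNum {G = complete N} {D = M} isγ
                                     (halves-complete M k |M|≡1+k (n≤2*⌈n/2⌉ (suc n′))) ⟩
    g                         ∎
    where open ℤₚ.≤-Reasoning

next prev : ℕ → ℕ → ℕ
next n i = if suc i ≡ᵇ n then 0 else suc i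
prev n zero    = n ∸ 1
prev n (suc i) = i

cycle-wraps : ∀ n (v u : Fin n) → ((toℕ u ≡ᵇ 0) ∧ (suc (toℕ v) ≡ᵇ n)) ≡ true →
              toℕ u ≡ next n (toℕ v)
cycle-wraps n v u u≡0∧1+v≡n
  rewrite Boolₚ.∧-conicalʳ (toℕ u ≡ᵇ 0) (suc (toℕ v) ≡ᵇ n) u≡0∧1+v≡n =
  ≡ᵇ⇒≡ (toℕ u) 0 (Boolₚ.∧-conicalˡ (toℕ u ≡ᵇ 0) _ u≡0∧1+v≡n)

cycle-adjacent : ∀ n (v u : Fin n) → cycle n v u ≡ true →
                 toℕ u ≡ next n (toℕ v) ⊎ toℕ u ≡ prev n (toℕ v)
cycle-adjacent n v u adj with toℕ u ≡ᵇ suc (toℕ v) in u≡1+v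
... | true with suc (toℕ v) ≡ᵇ n in 1+v≡n
...   | false = inj₁ (≡ᵇ⇒≡ (toℕ u) _ u≡1+v)
...   | true  = ⊥-elim (ℕₚ.<-irrefl (trans (≡ᵇ⇒≡ (toℕ u) _ u≡1+v) (≡ᵇ⇒≡ _ n 1+v≡n))
                                  (Finₚ.toℕ<n u))
cycle-adjacent n v u adj | false with toℕ v ≡ᵇ suc (toℕ u) in v≡1+u
... | true = inj₂ (cong (prev n) (sym (≡ᵇ⇒≡ (toℕ v) _ v≡1+u)))
... | false with toℕ v ≡ᵇ 0 in v≡0 | suc (toℕ u) ≡ᵇ n in 1+u≡n
...   | true  | true  = inj₂ (trans (cong (_∸ 1) (≡ᵇ⇒≡ (suc (toℕ u)) n 1+u≡n))
                                     (cong (prev n) (sym (≡ᵇ⇒≡ (toℕ v) 0 v≡0))))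
...   | true  | false = inj₁ (cycle-wraps n v u adj)
...   | false | true  = inj₁ (cycle-wraps n v u adj)
...   | false | false = inj₁ (cycle-wraps n v u adj)

deg-cycle≤2 : ∀ n (v : Fin n) → deg (cycle n) v ≤ 2
deg-cycle≤2 n v = ℕₚ.≤-trans
  (card-cover (cycle n v) (at (next n (toℕ v))) (at (prev n (toℕ v)))
              (λ u adj → ⊎-map ≡⇒≡ᵇ ≡⇒≡ᵇ (cycle-adjacent n v u adj)))
  (ℕₚ.+-mono-≤ (card-at≤1 n _) (card-at≤1 n _))
  where
  at : ℕ → Fin n → Bool
  at a u = toℕ u ≡ᵇ a

mainTheorem1 : ((n : ℕ) (G : Graph n) → IsSimple G → (δ : ℕ) → IsMinDegree G δ → 1 ≤ δ →
      (g : ℤ) (t : ℕ) → IsInvSignedTotalDomNum G g → IsTotalDomNum G t →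
      g ≤ℤ bound n t δ)
    × ((n : ℕ) → 2 ≤ n → (δ : ℕ) → IsMinDegree (complete n) δ →
      (g : ℤ) (t : ℕ) → IsInvSignedTotalDomNum (complete n) g → IsTotalDomNum (complete n) t →
      g ≡ bound n t δ)
    × ((n : ℕ) → 3 ≤ n → (δ : ℕ) → IsMinDegree (cycle n) δ →
      (g : ℤ) (t : ℕ) → IsInvSignedTotalDomNum (cycle n) g → IsTotalDomNum (cycle n) t →
      g ≡ bound n t δ)
mainTheorem1 =
  (λ _ _ _ _ minDeg 1≤δ _ _ → invSignedTotalDomNum≤bound minDeg 1≤δ) ,
  (λ _ 2≤n _ minDeg _ _ → invSignedTotalDomNum≡bound-complete 2≤n minDeg) ,
  (λ n _ _ minDeg _ _ → invSignedTotalDomNum≡bound-deg≤2 (deg-cycle≤2 n) minDeg)
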